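{- Let $H$ be a balanced dented hexagon. For each positive integer $N$, let $L_N$ be the $N$th horizontal lattice line south of the northern side of $H$, and let $\mu_N$ be the number of removed triangles (dents) of $H$ lying north of $L_N$. Then $H$ has a lozenge tiling if and only if $\mu_N\le N$ for all $N\in\mathbb N$.
   Context: Work on the triangular lattice with horizontal lattice lines. A region is a connected finite union of unit triangles; a lozenge is the union of two unit triangles sharing an edge; a lozenge tiling of a region is a covering of it by non-overlapping lozenges contained in it. A region is balanced if it contains equally many up-pointing and down-pointing unit triangles. For nonnegative integers $a,b,c,t$, $H_{a,b,c,t}$ is the lattice hexagon with side lengths, clockwise starting from the northern side, $a$ (north), $b+t$ (northeast), $c$ (southeast), $a+t$ (south), $b$ (southwest), $c+t$ (northwest). A unit triangle is "along" a side if it shares an edge with that side; the triangles along the northeast (resp. northwest) side are indexed $1,\dots,b+t$ (resp. $1,\dots,c+t$) from the north. Given $1\le u_1<\dots<u_m\le b+t$ and $1\le v_1<\dots<v_n\le c+t$ with $a>0$ or $u_1>1$ or $v_1>1$, the dented hexagon $H_{a,b,c,t,\vec u,\vec v}$ is obtained from $H_{a,b,c,t}$ by removing (these removed triangles are called dents) the $u_i$-th triangle along the northeast side for each $i$ and the $v_j$-th triangle along the northwest side for each $j$. It is balanced exactly when $t=m+n$. -}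

module Defs where

open import Data.Nat using (ℕ; zero; suc; _+_; _∸_; _≤_; _≤?_)
import Data.Nat as ℕ
open import Data.Bool using (Bool; true; false; _∨_)
open import Data.List using (List; []; _∷_; map; _++_; length; filter)
open import Data.List.Membership.Propositional using (_∈_)
open import Data.Product using (Σ; _×_)
open import Relation.Nullary using (¬_; Dec; yes; no)
open import Relation.Nullary.Decidable using (⌊_⌋; map′)
open import Relation.Binary.PropositionalEquality using (_≡_; refl; cong₂)

-- Lattice point (x , y)
-- is x·e₁ + y·e₂ with e₁ = (1,0), e₂ = (1/2, √3/2); y is the height.
--   up x y   : unit triangle with vertices (x,y), (x+1,y), (x,y+1)
--   down x y : unit triangle with vertices (x+1,y), (x,y+1), (x+1,y+1)
-- Only triangles with nonnegative coordinates are needed (the hexagon below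
-- lives in the quadrant x ≥ 0, y ≥ 0).
data Triangle : Set where
  up   : ℕ → ℕ → Triangle
  down : ℕ → ℕ → Triangle

row : Triangle → ℕ
row (up _ y)   = y
row (down _ y) = y

_≟ᵗ_ : (s t : Triangle) → Dec (s ≡ t)
up x y ≟ᵗ up x′ y′ with x ℕ.≟ x′ | y ℕ.≟ y′
... | yes refl | yes refl = yes refl
... | no p     | _        = no λ { refl → p refl }
... | yes _    | no q     = no λ { refl → q refl }
up _ _ ≟ᵗ down _ _ = no λ ()
down _ _ ≟ᵗ up _ _ = no λ ()
down x y ≟ᵗ down x′ y′ with x ℕ.≟ x′ | y ℕ.≟ y′
... | yes refl | yes refl = yes refl
... | no p     | _        = no λ { refl → p refl }
... | yes _    | no q     = no λ { refl → q refl }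

data Adjacent : Triangle → Triangle → Set where
  adj-diag  : ∀ {x y} → Adjacent (up x y) (down x y)
  adj-vert  : ∀ {x y} → Adjacent (up (suc x) y) (down x y)
  adj-horiz : ∀ {x y} → Adjacent (up x (suc y)) (down x y)

record Lozenge : Set where
  constructor lozenge
  field
    upT   : Triangle
    downT : Triangle
    adj   : Adjacent upT downT
open Lozenge public

contains : Lozenge → Triangle → Bool
contains ℓ Δ = ⌊ Δ ≟ᵗ upT ℓ ⌋ ∨ ⌊ Δ ≟ᵗ downT ℓ ⌋

coverCount : List Lozenge → Triangle → ℕ
coverCount []       Δ = 0
coverCount (ℓ ∷ L) Δ with contains ℓ Δ
... | true  = suc (coverCount L Δ)
... | false = coverCount L Δ

IsTiling : (Triangle → Set) → List Lozenge → Set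
IsTiling R L =
  (∀ ℓ → ℓ ∈ L → R (upT ℓ) × R (downT ℓ)) ×
  (∀ Δ → R Δ → coverCount L Δ ≡ 1)

HasTiling : (Triangle → Set) → Set
HasTiling R = Σ (List Lozenge) (IsTiling R)

-- With h = b+c+t, A = a+b+t, S = a+b+c+t, it is
--   { 0 ≤ y ≤ h , 0 ≤ x ≤ A , b ≤ x + y ≤ S }
-- with vertices (b,0), (A,0), (A,c), (a,h), (0,h), (0,b):
-- north side y = h (length a), northeast side x+y = S (length b+t),
-- southeast side x = A (length c), south side y = 0 (length a+t),
-- southwest side x+y = b (length b), northwest side x = 0 (length c+t).

height : ℕ → ℕ → ℕ → ℕ → ℕ
height a b c t = b + c + t

InHex : ℕ → ℕ → ℕ → ℕ → Triangle → Set
InHex a b c t (up x y) =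
  (y + 1 ≤ b + c + t) × (x + 1 ≤ a + b + t) × (b ≤ x + y) × (x + y + 1 ≤ a + b + c + t)
InHex a b c t (down x y) =
  (y + 1 ≤ b + c + t) × (x + 1 ≤ a + b + t) × (b ≤ x + y + 1) × (x + y + 2 ≤ a + b + c + t)

-- The k-th unit triangle (counted from the north, k ≥ 1) along the northeast
-- side: the up triangle in row h - k with an edge on x + y = S.
neDent : ℕ → ℕ → ℕ → ℕ → ℕ → Triangle
neDent a b c t k = up (a + (k ∸ 1)) (height a b c t ∸ k)

-- The k-th unit triangle (from the north) along the northwest side x = 0.
nwDent : ℕ → ℕ → ℕ → ℕ → ℕ → Triangle
nwDent a b c t k = up 0 (height a b c t ∸ k)

dents : ℕ → ℕ → ℕ → ℕ → List ℕ → List ℕ → List Triangle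
dents a b c t us vs = map (neDent a b c t) us ++ map (nwDent a b c t) vs

DentedHex : ℕ → ℕ → ℕ → ℕ → List ℕ → List ℕ → Triangle → Set
DentedHex a b c t us vs Δ = InHex a b c t Δ × ¬ (Δ ∈ dents a b c t us vs)

-- μ_N: number of dents lying north of L_N, the N-th horizontal lattice line
-- south of the northern side (the line y = h - N).  A triangle in row y lies
-- north of that line iff h - N ≤ y (for N > h every triangle is north of it).
mu : ℕ → ℕ → ℕ → ℕ → List ℕ → List ℕ → ℕ → ℕ
mu a b c t us vs N =
  length (filter (λ Δ → height a b c t ∸ N ≤? row Δ) (dents a b c t us vs))

-- Let U and D be the up- and down-pointing unit triangles of the undented
-- hexagon north of L_N. In a tiling each triangle of D shares its lozenge with an
-- up-pointing triangle of the same row or the row above, which lies in U and is not a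
-- dent; so D together with the μ_N dents injects into U. Conversely, every triangle of U
-- except the eastmost one of each of the N rows has its eastern neighbour in D. Hence
-- |D| + μ_N ≤ |U| ≤ |D| + N.
--
-- Sufficiency is an explicit tiling by straight paths. Number the rows from the north;
-- row k is a source if the k-th triangle along the northeast side is present, and a
-- sink if the row begins in the west with a down-pointing triangle, i.e. it is dented
-- along the northwest side or it meets the southwest side. Balance gives equally many
-- sources and sinks, and μ_j ≤ j gives that among the first j rows there are never more
-- sinks than sources. The r-th source then starts a column of lozenges with horizontal
-- inner edges, parallel to the northwest side, that ends in the r-th sink row; every
-- other triangle is paired with a neighbour in its own row, westwards in a sink row up
-- to the column ending there and eastwards otherwise.
module Submission where

open import Defs
open import Level using (0ℓ)
open import Data.Bool using (true; false)
open import Data.Nat using (ℕ; zero; suc; _+_; _∸_; _≤_; _<_; _≤?_; _<?_; _⊓_; z≤n; s≤s)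
import Data.Nat as ℕ
open import Data.Nat.Properties
open import Data.Nat.Tactic.RingSolver using (solve-∀)
open import Data.Product using (∃; ∃₂; _×_; _,_; proj₁; proj₂; uncurry)
open import Data.Sum using (_⊎_; inj₁; inj₂; [_,_])
open import Data.List using (List; []; _∷_; map; _++_; length; filter; upTo; applyUpTo; cartesianProduct; cartesianProductWith)
open import Data.List.Properties
  using (length-map; length-++; length-applyUpTo; length-filter; filter-notAll; filter-all; filter-none; filter-++)
open import Data.List.Membership.Propositional using (_∈_; _∉_)
open import Data.List.Membership.Propositional.Properties
  using (∈-filter⁺; ∈-filter⁻; ∈-map⁺; ∈-map⁻; ∈-++⁺ˡ; ∈-++⁺ʳ; ∈-++⁻; ∈-applyUpTo⁺; ∈-upTo⁺;
         ∈-cartesianProduct⁺; ∈-cartesianProductWith⁺; ∈-cartesianProductWith⁻)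
import Data.List.Membership.DecPropositional as DecMembership
open import Data.List.Membership.DecPropositional ℕ._≟_ using (_∈?_)
open import Data.List.Relation.Unary.Any as Any using (here; there)
open import Data.List.Relation.Unary.All as All using (All; []; _∷_)
import Data.List.Relation.Unary.All.Properties as All
open import Data.List.Relation.Unary.AllPairs as AllPairs using ([]; _∷_)
open import Data.List.Relation.Unary.Linked using (Linked)
open import Data.List.Relation.Unary.Linked.Properties using (Linked⇒AllPairs)
open import Data.List.Relation.Unary.Unique.Propositional using (Unique)
import Data.List.Relation.Unary.Unique.Propositional.Properties as Unique
open import Function.Base using (_∘_; case_of_)
open import Function.Bundles using (_⇔_; mk⇔)
open import Relation.Nullary using (¬_; Dec; yes; no; contradiction)
open import Relation.Nullary.Decidable using (¬?; _×-dec_; _⊎-dec_)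
open import Relation.Unary using (Pred; Decidable)
open import Relation.Binary.Definitions using (DecidableEquality)
open import Relation.Binary.PropositionalEquality
  using (_≡_; _≢_; refl; sym; trans; cong; cong₂; subst; subst₂; module ≡-Reasoning)

indicator : ∀ {P : Set} → Dec P → ℕ
indicator (yes _) = 1
indicator (no _)  = 0

indicator-yes : ∀ {P : Set} (P? : Dec P) → P → indicator P? ≡ 1
indicator-yes (yes _) _  = refl
indicator-yes (no ¬p) p = contradiction p ¬p

indicator-no : ∀ {P : Set} (P? : Dec P) → ¬ P → indicator P? ≡ 0
indicator-no (yes p) ¬p = contradiction p ¬p
indicator-no (no _)  _  = refl

indicator≤1 : ∀ {P : Set} (P? : Dec P) → indicator P? ≤ 1
indicator≤1 (yes _) = ≤-refl
indicator≤1 (no _)  = z≤n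

indicator-cong : ∀ {P Q : Set} (P? : Dec P) (Q? : Dec Q) → (P → Q) → (Q → P) → indicator P? ≡ indicator Q?
indicator-cong (yes _) (yes _) _   _   = refl
indicator-cong (no _)  (no _)  _   _   = refl
indicator-cong (yes p) (no ¬q) p→q _   = contradiction (p→q p) ¬q
indicator-cong (no ¬p) (yes q) _   q→p = contradiction (q→p q) ¬p

countUpTo : ∀ {P : ℕ → Set} → (∀ k → Dec (P k)) → ℕ → ℕ
countUpTo P? zero    = 0
countUpTo P? (suc k) = countUpTo P? k + indicator (P? (suc k))

module _ {P : ℕ → Set} (P? : ∀ k → Dec (P k)) where

  countUpTo-suc-yes : ∀ {k} → P (suc k) → countUpTo P? (suc k) ≡ suc (countUpTo P? k)
  countUpTo-suc-yes {k} p = trans (cong (countUpTo P? k +_) (indicator-yes (P? (suc k)) p)) (+-comm (countUpTo P? k) 1)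

  countUpTo-suc-no : ∀ {k} → ¬ P (suc k) → countUpTo P? (suc k) ≡ countUpTo P? k
  countUpTo-suc-no {k} ¬p = trans (cong (countUpTo P? k +_) (indicator-no (P? (suc k)) ¬p)) (+-identityʳ (countUpTo P? k))

  countUpTo-mono : ∀ {j k} → j ≤ k → countUpTo P? j ≤ countUpTo P? k
  countUpTo-mono {k = zero}  z≤n   = ≤-refl
  countUpTo-mono {j} {suc k} j≤1+k with m≤n⇒m<n∨m≡n j≤1+k
  ... | inj₁ j<1+k = ≤-trans (countUpTo-mono (≤-pred j<1+k)) (m≤m+n (countUpTo P? k) _)
  ... | inj₂ refl  = ≤-refl

  countUpTo≤ : ∀ k → countUpTo P? k ≤ k
  countUpTo≤ zero    = z≤n
  countUpTo≤ (suc k) = subst (countUpTo P? (suc k) ≤_) (+-comm k 1) (+-mono-≤ (countUpTo≤ k) (indicator≤1 (P? (suc k))))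

module _ {A B : Set} where

  Unique-map⁺ : ∀ {f : A → B} {xs} → Unique xs →
                (∀ {x y} → x ∈ xs → y ∈ xs → f x ≡ f y → x ≡ y) → Unique (map f xs)
  Unique-map⁺ {xs = []}     []           _   = []
  Unique-map⁺ {xs = x ∷ xs} (x∉xs ∷ xs!) inj =
    All.map⁺ (All.tabulate λ y∈xs fx≡fy → All.lookup x∉xs y∈xs (inj (here refl) (there y∈xs) fx≡fy))
    ∷ Unique-map⁺ xs! (λ p q → inj (there p) (there q))

  injection⇒length≤ : DecidableEquality B → ∀ {xs : List A} {ys : List B} → Unique xs →
                      (f : ∀ {x} → x ∈ xs → B) → (∀ {x} (p : x ∈ xs) → f p ∈ ys) →
                      (∀ {x y} (p : x ∈ xs) (q : y ∈ xs) → f p ≡ f q → x ≡ y) →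
                      length xs ≤ length ys
  injection⇒length≤ _≟_ {[]}     _            _ _  _   = z≤n
  injection⇒length≤ _≟_ {x ∷ xs} {ys} (x∉xs ∷ xs!) f f∈ inj = begin-strict
    length xs                ≤⟨ injection⇒length≤ _≟_ xs! (f ∘ there) f∈ys′ (λ p q → inj (there p) (there q)) ⟩
    length (filter ≢fx? ys)  <⟨ filter-notAll ≢fx? ys (Any.map (λ e ne → ne (sym e)) (f∈ (here refl))) ⟩
    length ys                ∎
    where
    open ≤-Reasoning
    ≢fx? : Decidable (λ z → ¬ z ≡ f (here refl))
    ≢fx? z = ¬? (z ≟ f (here refl))
    f∈ys′ : ∀ {y} (p : y ∈ xs) → f (there p) ∈ filter ≢fx? ys
    f∈ys′ p = ∈-filter⁺ ≢fx? (f∈ (there p)) (λ e → All.lookup x∉xs p (sym (inj (there p) (here refl) e)))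

  length-filter-map : ∀ {P : Pred B 0ℓ} {Q : Pred A 0ℓ} (P? : Decidable P) (Q? : Decidable Q) (f : A → B) {xs} →
                      (∀ {x} → x ∈ xs → P (f x) → Q x) → (∀ {x} → x ∈ xs → Q x → P (f x)) →
                      length (filter P? (map f xs)) ≡ length (filter Q? xs)
  length-filter-map P? Q? f {[]}     _  _  = refl
  length-filter-map P? Q? f {x ∷ xs} to fr with P? (f x) | Q? x
  ... | yes _  | yes _  = cong suc (length-filter-map P? Q? f (to ∘ there) (fr ∘ there))
  ... | no _   | no _   = length-filter-map P? Q? f (to ∘ there) (fr ∘ there)
  ... | yes p  | no ¬q  = contradiction (to (here refl) p) ¬q
  ... | no ¬p  | yes q  = contradiction (fr (here refl) q) ¬p

length-filter-∷ : ∀ {A : Set} {P : Pred A 0ℓ} (P? : Decidable P) {x xs} →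
                  length (filter P? (x ∷ xs)) ≡ indicator (P? x) + length (filter P? xs)
length-filter-∷ P? {x} with P? x
... | yes _ = refl
... | no _  = refl

atMost : ℕ → List ℕ → ℕ
atMost n xs = length (filter (_≤? n) xs)

atMost-zero : ∀ {xs} → All (1 ≤_) xs → atMost 0 xs ≡ 0
atMost-zero positive = cong length (filter-none (_≤? 0) (All.map <⇒≱ positive))

atMost-all : ∀ {n xs} → All (_≤ n) xs → atMost n xs ≡ length xs
atMost-all bounded = cong length (filter-all (_≤? _) bounded)

private
  indicator-≤?-suc : ∀ {x n} → x ≢ suc n → indicator (x ≤? suc n) ≡ indicator (x ≤? n)
  indicator-≤?-suc {x} {n} x≢1+n = indicator-cong (x ≤? suc n) (x ≤? n)
    (λ x≤1+n → ≤-pred (≤∧≢⇒< x≤1+n x≢1+n)) m≤n⇒m≤1+n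

atMost-suc-∉ : ∀ {n xs} → suc n ∉ xs → atMost (suc n) xs ≡ atMost n xs
atMost-suc-∉ {n} {[]}     _    = refl
atMost-suc-∉ {n} {x ∷ xs} 1+n∉ = begin
  atMost (suc n) (x ∷ xs)                    ≡⟨ length-filter-∷ (_≤? suc n) {x} {xs} ⟩
  indicator (x ≤? suc n) + atMost (suc n) xs ≡⟨ cong₂ _+_ (indicator-≤?-suc (λ x≡1+n → 1+n∉ (here (sym x≡1+n))))
                                                          (atMost-suc-∉ (1+n∉ ∘ there)) ⟩
  indicator (x ≤? n) + atMost n xs           ≡⟨ length-filter-∷ (_≤? n) {x} {xs} ⟨
  atMost n (x ∷ xs)                          ∎
  where open ≡-Reasoning

atMost-suc-∈ : ∀ {n xs} → Unique xs → suc n ∈ xs → atMost (suc n) xs ≡ suc (atMost n xs)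
atMost-suc-∈ {n} {x ∷ xs} (x∉xs ∷ _) (here refl) = begin
  atMost (suc n) (x ∷ xs)                    ≡⟨ length-filter-∷ (_≤? suc n) {x} {xs} ⟩
  indicator (x ≤? suc n) + atMost (suc n) xs ≡⟨ cong₂ _+_ (indicator-yes (x ≤? suc n) ≤-refl)
                                                          (atMost-suc-∉ (λ x∈xs → All.lookup x∉xs x∈xs refl)) ⟩
  1 + atMost n xs                            ≡⟨ cong (λ i → suc (i + atMost n xs)) (indicator-no (x ≤? n) 1+n≰n) ⟨
  suc (indicator (x ≤? n) + atMost n xs)     ≡⟨ cong suc (length-filter-∷ (_≤? n) {x} {xs}) ⟨
  suc (atMost n (x ∷ xs))                    ∎
  where open ≡-Reasoning
atMost-suc-∈ {n} {x ∷ xs} (x∉xs ∷ xs!) (there 1+n∈) = begin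
  atMost (suc n) (x ∷ xs)                    ≡⟨ length-filter-∷ (_≤? suc n) {x} {xs} ⟩
  indicator (x ≤? suc n) + atMost (suc n) xs ≡⟨ cong₂ _+_ (indicator-≤?-suc (All.lookup x∉xs 1+n∈)) (atMost-suc-∈ xs! 1+n∈) ⟩
  indicator (x ≤? n) + suc (atMost n xs)     ≡⟨ +-suc _ _ ⟩
  suc (indicator (x ≤? n) + atMost n xs)     ≡⟨ cong suc (length-filter-∷ (_≤? n) {x} {xs}) ⟨
  suc (atMost n (x ∷ xs))                    ∎
  where open ≡-Reasoning

up-injective : ∀ {x y x′ y′} → up x y ≡ up x′ y′ → (x , y) ≡ (x′ , y′)
up-injective refl = refl

flip : Triangle → Triangle
flip (up x y)   = down x y
flip (down x y) = up x y

flip-injective : ∀ {Δ Δ′} → flip Δ ≡ flip Δ′ → Δ ≡ Δ′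
flip-injective {up _ _}   {up _ _}   refl = refl
flip-injective {down _ _} {down _ _} refl = refl

upT≢down : ∀ ℓ {x y} → upT ℓ ≢ down x y
upT≢down (lozenge _ _ adj-diag)  ()
upT≢down (lozenge _ _ adj-vert)  ()
upT≢down (lozenge _ _ adj-horiz) ()

downT≢up : ∀ ℓ {x y} → downT ℓ ≢ up x y
downT≢up (lozenge _ _ adj-diag)  ()
downT≢up (lozenge _ _ adj-vert)  ()
downT≢up (lozenge _ _ adj-horiz) ()

upT-shape : ∀ ℓ → ∃₂ λ x y → upT ℓ ≡ up x y
upT-shape (lozenge _ _ adj-diag)  = _ , _ , refl
upT-shape (lozenge _ _ adj-vert)  = _ , _ , refl
upT-shape (lozenge _ _ adj-horiz) = _ , _ , refl

row-downT≤row-upT : ∀ ℓ → row (downT ℓ) ≤ row (upT ℓ)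
row-downT≤row-upT (lozenge _ _ adj-diag)            = ≤-refl
row-downT≤row-upT (lozenge _ _ adj-vert)            = ≤-refl
row-downT≤row-upT (lozenge _ _ (adj-horiz {y = y})) = n≤1+n y

contains⁻ : ∀ ℓ {Δ} → contains ℓ Δ ≡ true → Δ ≡ upT ℓ ⊎ Δ ≡ downT ℓ
contains⁻ ℓ {Δ} _ with Δ ≟ᵗ upT ℓ | Δ ≟ᵗ downT ℓ
... | yes Δ≡upT | _           = inj₁ Δ≡upT
... | no _      | yes Δ≡downT = inj₂ Δ≡downT

contains-up⁻ : ∀ ℓ {x y} → contains ℓ (up x y) ≡ true → upT ℓ ≡ up x y
contains-up⁻ ℓ c with contains⁻ ℓ c
... | inj₁ up≡upT   = sym up≡upT
... | inj₂ up≡downT = contradiction (sym up≡downT) (downT≢up ℓ)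

contains-down⁻ : ∀ ℓ {x y} → contains ℓ (down x y) ≡ true → downT ℓ ≡ down x y
contains-down⁻ ℓ c with contains⁻ ℓ c
... | inj₁ down≡upT   = contradiction (sym down≡upT) (upT≢down ℓ)
... | inj₂ down≡downT = sym down≡downT

contains-upT : ∀ ℓ → contains ℓ (upT ℓ) ≡ true
contains-upT ℓ with upT ℓ ≟ᵗ upT ℓ
... | yes _     = refl
... | no ¬refl  = contradiction refl ¬refl

contains-downT : ∀ ℓ → contains ℓ (downT ℓ) ≡ true
contains-downT ℓ with downT ℓ ≟ᵗ upT ℓ | downT ℓ ≟ᵗ downT ℓ
... | yes _ | _     = refl
... | no _  | yes _    = refl
... | no _  | no ¬refl = contradiction refl ¬refl

coverCount-positive : ∀ {L ℓ Δ} → ℓ ∈ L → contains ℓ Δ ≡ true → 1 ≤ coverCount L Δ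
coverCount-positive {ℓ′ ∷ L} {ℓ} {Δ} ℓ∈ c with contains ℓ′ Δ in c′
... | true = s≤s z≤n
coverCount-positive (here refl) c | false = contradiction (trans (sym c) c′) λ ()
coverCount-positive (there ℓ∈) c | false = coverCount-positive ℓ∈ c

covering : ∀ L {Δ} → 1 ≤ coverCount L Δ → ∃ λ ℓ → ℓ ∈ L × contains ℓ Δ ≡ true
covering (ℓ ∷ L) {Δ} pos with contains ℓ Δ in c
... | true  = ℓ , here refl , c
... | false with covering L pos
...   | ℓ′ , ℓ′∈ , c′ = ℓ′ , there ℓ′∈ , c′

covering-unique : ∀ L {Δ ℓ₁ ℓ₂} → coverCount L Δ ≡ 1 → ℓ₁ ∈ L → ℓ₂ ∈ L →
                  contains ℓ₁ Δ ≡ true → contains ℓ₂ Δ ≡ true → ℓ₁ ≡ ℓ₂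
covering-unique (ℓ ∷ L) {Δ} once ℓ₁∈ ℓ₂∈ c₁ c₂ with contains ℓ Δ in c
... | true  = trans (isHead ℓ₁∈ c₁) (sym (isHead ℓ₂∈ c₂))
  where
  isHead : ∀ {ℓ′} → ℓ′ ∈ ℓ ∷ L → contains ℓ′ Δ ≡ true → ℓ′ ≡ ℓ
  isHead (here refl) _ = refl
  isHead (there ℓ′∈) c′ = contradiction (subst (1 ≤_) (suc-injective once) (coverCount-positive ℓ′∈ c′)) λ ()
... | false = covering-unique L once (inTail ℓ₁∈ c₁) (inTail ℓ₂∈ c₂) c₁ c₂
  where
  inTail : ∀ {ℓ′} → ℓ′ ∈ ℓ ∷ L → contains ℓ′ Δ ≡ true → ℓ′ ∈ L
  inTail (here refl) c′ = contradiction (trans (sym c′) c) λ ()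
  inTail (there ℓ′∈) _ = ℓ′∈

coverCount≡0 : ∀ L {Δ} → (∀ {ℓ} → ℓ ∈ L → contains ℓ Δ ≢ true) → coverCount L Δ ≡ 0
coverCount≡0 []      _    = refl
coverCount≡0 (ℓ ∷ L) {Δ} none with contains ℓ Δ in c
... | true  = contradiction c (none (here refl))
... | false = coverCount≡0 L (none ∘ there)

coverCount-map≡1 : ∀ {A : Set} (f : A → Lozenge) {xs w Δ} → Unique xs → w ∈ xs → contains (f w) Δ ≡ true →
                   (∀ {u} → u ∈ xs → contains (f u) Δ ≡ true → u ≡ w) → coverCount (map f xs) Δ ≡ 1
coverCount-map≡1 f {x ∷ xs} {w} {Δ} (x∉xs ∷ xs!) w∈ cw only with contains (f x) Δ in c
... | true  = cong suc (coverCount≡0 (map f xs) none)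
  where
  none : ∀ {ℓ} → ℓ ∈ map f xs → contains ℓ Δ ≢ true
  none ℓ∈ cℓ with ∈-map⁻ f ℓ∈
  ... | u , u∈ , refl = All.lookup x∉xs u∈ (trans (only (here refl) c) (sym (only (there u∈) cℓ)))
... | false with w∈
...   | here refl  = contradiction (trans (sym cw) c) λ ()
...   | there w∈xs = coverCount-map≡1 f xs! w∈xs cw (only ∘ there)

module Hexagon (a b c t : ℕ) (us vs : List ℕ)
               (us-range : All (λ u → 1 ≤ u × u ≤ b + t) us)
               (vs-range : All (λ v → 1 ≤ v × v ≤ c + t) vs) where

  h : ℕ
  h = b + c + t

  Region : Triangle → Set
  Region = DentedHex a b c t us vs

  Dents : List Triangle
  Dents = dents a b c t us vs

  inHex? : ∀ Δ → Dec (InHex a b c t Δ)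
  inHex? (up x y)   = (y + 1 ≤? h) ×-dec (x + 1 ≤? a + b + t) ×-dec (b ≤? x + y) ×-dec (x + y + 1 ≤? a + b + c + t)
  inHex? (down x y) = (y + 1 ≤? h) ×-dec (x + 1 ≤? a + b + t) ×-dec (b ≤? x + y + 1) ×-dec (x + y + 2 ≤? a + b + c + t)

  region? : ∀ Δ → Dec (Region Δ)
  region? Δ = inHex? Δ ×-dec ¬? (DecMembership._∈?_ _≟ᵗ_ Δ Dents)

  b+t≤h : b + t ≤ h
  b+t≤h = +-monoˡ-≤ t (m≤m+n b c)

  c+t≤h : c + t ≤ h
  c+t≤h = subst (c + t ≤_) (sym (+-assoc b c t)) (m≤n+m (c + t) b)

  us≤h : ∀ {k} → k ∈ us → k ≤ h
  us≤h k∈ = ≤-trans (proj₂ (All.lookup us-range k∈)) b+t≤h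

  vs≤h : ∀ {k} → k ∈ vs → k ≤ h
  vs≤h k∈ = ≤-trans (proj₂ (All.lookup vs-range k∈)) c+t≤h

  -- A triangle of row y is addressed by its column x and by k = h ∸ y, the index of its
  -- row counted from the north starting at 1; the pair (y , k) comes with y + k ≡ h.
  UpInside : ℕ → ℕ → Set
  UpInside x k = 1 ≤ k × suc x ≤ a + b + t × k ≤ x + (c + t) × suc x ≤ a + k

  DownInside : ℕ → ℕ → Set
  DownInside x k = 1 ≤ k × suc x ≤ a + b + t × k ≤ suc x + (c + t) × suc (suc x) ≤ a + k

  IsDent : ℕ → ℕ → Set
  IsDent x k = (suc x ≡ a + k × k ∈ us) ⊎ (x ≡ 0 × k ∈ vs)

  module RowIndex {y k : ℕ} (y+k≡h : y + k ≡ h) where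

    h∸y≡k : h ∸ y ≡ k
    h∸y≡k = trans (cong (_∸ y) (sym y+k≡h)) (m+n∸m≡n y k)

    h∸k≡y : h ∸ k ≡ y
    h∸k≡y = trans (cong (_∸ k) (sym y+k≡h)) (m+n∸n≡m y k)

    private
      b+[m+ct]≡m+[y+k] : ∀ m → b + (m + (c + t)) ≡ m + (y + k)
      b+[m+ct]≡m+[y+k] m = trans (lemma m b c t) (cong (m +_) (sym y+k≡h))
        where
        lemma : ∀ m b c t → b + (m + (c + t)) ≡ m + (b + c + t)
        lemma = solve-∀

      S≡a+k+y : a + b + c + t ≡ a + k + y
      S≡a+k+y = trans (lemma a b c t) (trans (cong (a +_) (sym y+k≡h)) (lemma′ a y k))
        where
        lemma : ∀ a b c t → a + b + c + t ≡ a + (b + c + t)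
        lemma = solve-∀
        lemma′ : ∀ a y k → a + (y + k) ≡ a + k + y
        lemma′ = solve-∀

    top⁺ : y + 1 ≤ h → 1 ≤ k
    top⁺ le = +-cancelˡ-≤ y 1 k (subst (y + 1 ≤_) (sym y+k≡h) le)

    top⁻ : 1 ≤ k → y + 1 ≤ h
    top⁻ le = subst (y + 1 ≤_) y+k≡h (+-monoʳ-≤ y le)

    west⁺ : ∀ m → b ≤ m + y → k ≤ m + (c + t)
    west⁺ m le = +-cancelˡ-≤ b k (m + (c + t)) (begin
      b + k          ≤⟨ +-monoˡ-≤ k le ⟩
      m + y + k      ≡⟨ +-assoc m y k ⟩
      m + (y + k)    ≡⟨ b+[m+ct]≡m+[y+k] m ⟨
      b + (m + (c + t)) ∎)
      where open ≤-Reasoning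

    west⁻ : ∀ m → k ≤ m + (c + t) → b ≤ m + y
    west⁻ m le = +-cancelʳ-≤ k b (m + y) (begin
      b + k             ≤⟨ +-monoʳ-≤ b le ⟩
      b + (m + (c + t)) ≡⟨ b+[m+ct]≡m+[y+k] m ⟩
      m + (y + k)       ≡⟨ +-assoc m y k ⟨
      m + y + k         ∎)
      where open ≤-Reasoning

    east⁺ : ∀ m → m + y ≤ a + b + c + t → m ≤ a + k
    east⁺ m le = +-cancelʳ-≤ y m (a + k) (subst (m + y ≤_) S≡a+k+y le)

    east⁻ : ∀ m → m ≤ a + k → m + y ≤ a + b + c + t
    east⁻ m le = subst (m + y ≤_) (sym S≡a+k+y) (+-monoˡ-≤ y le)

  module _ {x y k : ℕ} (y+k≡h : y + k ≡ h) where
    open RowIndex {y} {k} y+k≡h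

    up-inside⁺ : InHex a b c t (up x y) → UpInside x k
    up-inside⁺ (y<h , x<A , sw , ne) =
      top⁺ y<h , subst (_≤ a + b + t) (+-comm x 1) x<A , west⁺ x sw , east⁺ (suc x) (subst (_≤ a + b + c + t) (+-comm (x + y) 1) ne)

    up-inside⁻ : UpInside x k → InHex a b c t (up x y)
    up-inside⁻ (1≤k , x<A , sw , ne) =
      top⁻ 1≤k , subst (_≤ a + b + t) (+-comm 1 x) x<A , west⁻ x sw , subst (_≤ a + b + c + t) (+-comm 1 (x + y)) (east⁻ (suc x) ne)

    down-inside⁺ : InHex a b c t (down x y) → DownInside x k
    down-inside⁺ (y<h , x<A , sw , ne) =
      top⁺ y<h , subst (_≤ a + b + t) (+-comm x 1) x<A ,
      west⁺ (suc x) (subst (b ≤_) (+-comm (x + y) 1) sw) , east⁺ (suc (suc x)) (subst (_≤ a + b + c + t) (+-comm (x + y) 2) ne)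

    down-inside⁻ : DownInside x k → InHex a b c t (down x y)
    down-inside⁻ (1≤k , x<A , sw , ne) =
      top⁻ 1≤k , subst (_≤ a + b + t) (+-comm 1 x) x<A ,
      subst (b ≤_) (+-comm 1 (x + y)) (west⁻ (suc x) sw) , subst (_≤ a + b + c + t) (+-comm 2 (x + y)) (east⁻ (suc (suc x)) ne)

  south-neighbour-inside : ∀ {x k} → UpInside x k → DownInside x (suc k)
  south-neighbour-inside {x} {k} (_ , x<A , sw , ne) = s≤s z≤n , x<A , s≤s sw , subst (suc (suc x) ≤_) (sym (+-suc a k)) (s≤s ne)

  west-neighbour-inside : ∀ {x k} → UpInside (suc x) k → DownInside x k
  west-neighbour-inside (1≤k , x<A , sw , ne) = 1≤k , <⇒≤ x<A , sw , ne

  y+[h∸y]≡h : ∀ {y} → y + 1 ≤ h → y + (h ∸ y) ≡ h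
  y+[h∸y]≡h {y} y<h = m+[n∸m]≡n (≤-trans (m≤m+n y 1) y<h)

  1+y+[h∸[1+y]]≡h : ∀ {y} → y + 1 ≤ h → suc y + (h ∸ suc y) ≡ h
  1+y+[h∸[1+y]]≡h {y} y<h = m+[n∸m]≡n (subst (_≤ h) (+-comm y 1) y<h)

  y+[1+[h∸[1+y]]]≡h : ∀ {y} → y + 1 ≤ h → y + suc (h ∸ suc y) ≡ h
  y+[1+[h∸[1+y]]]≡h {y} y<h = trans (+-suc y (h ∸ suc y)) (1+y+[h∸[1+y]]≡h y<h)

  h∸y≡1+[h∸[1+y]] : ∀ {y} → y + 1 ≤ h → h ∸ y ≡ suc (h ∸ suc y)
  h∸y≡1+[h∸[1+y]] y<h = RowIndex.h∸y≡k (y+[1+[h∸[1+y]]]≡h y<h)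

  ∈-dents⁻ : ∀ {Δ} → Δ ∈ Dents →
             (∃ λ k → k ∈ us × Δ ≡ neDent a b c t k) ⊎ (∃ λ k → k ∈ vs × Δ ≡ nwDent a b c t k)
  ∈-dents⁻ Δ∈ with ∈-++⁻ (map (neDent a b c t) us) Δ∈
  ... | inj₁ Δ∈ne = inj₁ (∈-map⁻ (neDent a b c t) Δ∈ne)
  ... | inj₂ Δ∈nw = inj₂ (∈-map⁻ (nwDent a b c t) Δ∈nw)

  down∉Dents : ∀ {x y} → down x y ∉ Dents
  down∉Dents d∈ with ∈-dents⁻ d∈
  ... | inj₁ (_ , _ , ())
  ... | inj₂ (_ , _ , ())

  private
    suc[k∸1]≡k : ∀ {k} → 1 ≤ k → suc (k ∸ 1) ≡ k
    suc[k∸1]≡k = m+[n∸m]≡n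

  module _ {x y k : ℕ} (y+k≡h : y + k ≡ h) where
    open RowIndex {y} {k} y+k≡h

    private
      dent-row : ∀ {k₀} → k₀ ≤ h → y ≡ h ∸ k₀ → k ≡ k₀
      dent-row k₀≤h refl = trans (sym h∸y≡k) (m∸[m∸n]≡n k₀≤h)

    isDent⁺ : up x y ∈ Dents → IsDent x k
    isDent⁺ d∈ with ∈-dents⁻ d∈
    ... | inj₁ (k₀ , k₀∈ , refl) = inj₁ (trans (sym (+-suc a (k₀ ∸ 1))) (cong (a +_) (trans (suc[k∸1]≡k 1≤k₀) (sym k≡k₀))) ,
                                        subst (_∈ us) (sym k≡k₀) k₀∈)
      where
      1≤k₀ : 1 ≤ k₀
      1≤k₀ = proj₁ (All.lookup us-range k₀∈)
      k≡k₀ : k ≡ k₀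
      k≡k₀ = dent-row (us≤h k₀∈) refl
    ... | inj₂ (k₀ , k₀∈ , refl) = inj₂ (refl , subst (_∈ vs) (sym k≡k₀) k₀∈)
      where
      k≡k₀ : k ≡ k₀
      k≡k₀ = dent-row (vs≤h k₀∈) refl

    isDent⁻ : IsDent x k → up x y ∈ Dents
    isDent⁻ (inj₁ (1+x≡a+k , k∈)) =
      subst (_∈ Dents) (cong₂ up x≡ h∸k≡y) (∈-++⁺ˡ (∈-map⁺ (neDent a b c t) k∈))
      where
      x≡ : a + (k ∸ 1) ≡ x
      x≡ = suc-injective (trans (sym (+-suc a (k ∸ 1)))
                           (trans (cong (a +_) (suc[k∸1]≡k (proj₁ (All.lookup us-range k∈)))) (sym 1+x≡a+k)))
    isDent⁻ (inj₂ (refl , k∈)) =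
      subst (_∈ Dents) (cong (up 0) h∸k≡y) (∈-++⁺ʳ (map (neDent a b c t) us) (∈-map⁺ (nwDent a b c t) k∈))

  UpCell : ℕ → ℕ → Set
  UpCell x k = UpInside x k × ¬ IsDent x k

  module _ {x y k : ℕ} (y+k≡h : y + k ≡ h) where

    up-cell⁺ : Region (up x y) → UpCell x k
    up-cell⁺ (inside , ¬dent) = up-inside⁺ y+k≡h inside , ¬dent ∘ isDent⁻ y+k≡h

    up-cell⁻ : UpCell x k → Region (up x y)
    up-cell⁻ (inside , ¬dent) = up-inside⁻ y+k≡h inside , ¬dent ∘ isDent⁺ y+k≡h

    down-cell⁺ : Region (down x y) → DownInside x k
    down-cell⁺ (inside , _) = down-inside⁺ y+k≡h inside

    down-cell⁻ : DownInside x k → Region (down x y)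
    down-cell⁻ inside = down-inside⁻ y+k≡h inside , down∉Dents

  dent-inside : 1 ≤ t → ∀ {Δ} → Δ ∈ Dents → ∃₂ λ x y → Δ ≡ up x y × InHex a b c t (up x y)
  dent-inside 1≤t Δ∈ with ∈-dents⁻ Δ∈
  ... | inj₁ (k , k∈ , refl) = _ , _ , refl , up-inside⁻ (m∸n+n≡m (us≤h k∈)) (1≤k , a+k≤A′ , k≤x+ct , ≤-reflexive 1+x≡a+k)
    where
    1≤k : 1 ≤ k
    1≤k = proj₁ (All.lookup us-range k∈)
    k≤b+t : k ≤ b + t
    k≤b+t = proj₂ (All.lookup us-range k∈)
    1+x≡a+k : suc (a + (k ∸ 1)) ≡ a + k
    1+x≡a+k = trans (sym (+-suc a (k ∸ 1))) (cong (a +_) (suc[k∸1]≡k 1≤k))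
    a+k≤A′ : suc (a + (k ∸ 1)) ≤ a + b + t
    a+k≤A′ = subst₂ _≤_ (sym 1+x≡a+k) (sym (+-assoc a b t)) (+-monoʳ-≤ a k≤b+t)
    k≤x+ct : k ≤ a + (k ∸ 1) + (c + t)
    k≤x+ct = begin
      k                       ≡⟨ suc[k∸1]≡k 1≤k ⟨
      suc (k ∸ 1)             ≡⟨ +-comm 1 (k ∸ 1) ⟩
      k ∸ 1 + 1               ≤⟨ +-monoʳ-≤ (k ∸ 1) (≤-trans 1≤t (m≤n+m t c)) ⟩
      k ∸ 1 + (c + t)         ≤⟨ +-monoˡ-≤ (c + t) (m≤n+m (k ∸ 1) a) ⟩
      a + (k ∸ 1) + (c + t)   ∎
      where open ≤-Reasoning
  ... | inj₂ (k , k∈ , refl) =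
    _ , _ , refl , up-inside⁻ (m∸n+n≡m (vs≤h k∈)) (1≤k , ≤-trans 1≤t (m≤n+m t (a + b)) , k≤c+t , ≤-trans 1≤k (m≤n+m k a))
    where
    1≤k : 1 ≤ k
    1≤k = proj₁ (All.lookup vs-range k∈)
    k≤c+t : k ≤ c + t
    k≤c+t = proj₂ (All.lookup vs-range k∈)

  mu≡atMost : ∀ N → mu a b c t us vs N ≡ atMost N us + atMost N vs
  mu≡atMost N = begin
    mu a b c t us vs N
      ≡⟨ cong length (filter-++ north? (map (neDent a b c t) us) (map (nwDent a b c t) vs)) ⟩
    length (filter north? (map (neDent a b c t) us) ++ filter north? (map (nwDent a b c t) vs))
      ≡⟨ length-++ (filter north? (map (neDent a b c t) us)) ⟩
    length (filter north? (map (neDent a b c t) us)) + length (filter north? (map (nwDent a b c t) vs))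
      ≡⟨ cong₂ _+_ (length-filter-map north? (_≤? N) (neDent a b c t) (to ∘ us≤h) (λ _ → from))
                   (length-filter-map north? (_≤? N) (nwDent a b c t) (to ∘ vs≤h) (λ _ → from)) ⟩
    atMost N us + atMost N vs ∎
    where
    open ≡-Reasoning
    north? : ∀ Δ → Dec (h ∸ N ≤ row Δ)
    north? Δ = h ∸ N ≤? row Δ
    to : ∀ {k} → k ≤ h → h ∸ N ≤ h ∸ k → k ≤ N
    to k≤h le = ≮⇒≥ (λ N<k → <⇒≱ (∸-monoʳ-< N<k k≤h) le)
    from : ∀ {k} → k ≤ N → h ∸ N ≤ h ∸ k
    from = ∸-monoʳ-≤ h

  dents-unique : Unique us → Unique vs → (0 < a ⊎ All (1 <_) us ⊎ All (1 <_) vs) → Unique Dents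
  dents-unique us! vs! nondegenerate =
    Unique.++⁺ (Unique-map⁺ us! (λ k₁∈ k₂∈ → same-row (us≤h k₁∈) (us≤h k₂∈)))
               (Unique-map⁺ vs! (λ k₁∈ k₂∈ → same-row (vs≤h k₁∈) (vs≤h k₂∈)))
               ne≢nw
    where
    same-row : ∀ {k₁ k₂ x₁ x₂} → k₁ ≤ h → k₂ ≤ h → up x₁ (h ∸ k₁) ≡ up x₂ (h ∸ k₂) → k₁ ≡ k₂
    same-row k₁≤h k₂≤h e = ∸-cancelˡ-≡ k₁≤h k₂≤h (cong row e)
    column : Triangle → ℕ
    column (up x _)   = x
    column (down x _) = x
    -- With a = 0 the first triangles along the two northern sides coincide.
    ne≢nw : ∀ {Δ} → ¬ (Δ ∈ map (neDent a b c t) us × Δ ∈ map (nwDent a b c t) vs)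
    ne≢nw (ne∈ , nw∈) with ∈-map⁻ (neDent a b c t) ne∈ | ∈-map⁻ (nwDent a b c t) nw∈
    ... | k₁ , k₁∈ , refl | k₂ , k₂∈ , e = corner nondegenerate
      where
      a+[k₁∸1]≡0 : a + (k₁ ∸ 1) ≡ 0
      a+[k₁∸1]≡0 = cong column e
      a≡0 : a ≡ 0
      a≡0 = m+n≡0⇒m≡0 a a+[k₁∸1]≡0
      k₁≡1 : k₁ ≡ 1
      k₁≡1 = trans (sym (suc[k∸1]≡k (proj₁ (All.lookup us-range k₁∈)))) (cong suc (m+n≡0⇒n≡0 a a+[k₁∸1]≡0))
      k₂≡1 : k₂ ≡ 1
      k₂≡1 = trans (sym (same-row (us≤h k₁∈) (vs≤h k₂∈) e)) k₁≡1
      corner : ¬ (0 < a ⊎ All (1 <_) us ⊎ All (1 <_) vs)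
      corner (inj₁ 0<a)          = <-irrefl (sym a≡0) 0<a
      corner (inj₂ (inj₁ 1<us)) = <-irrefl (sym k₁≡1) (All.lookup 1<us k₁∈)
      corner (inj₂ (inj₂ 1<vs)) = <-irrefl (sym k₂≡1) (All.lookup 1<vs k₂∈)

module Necessity (a b c t : ℕ) (us vs : List ℕ)
                 (us-range : All (λ u → 1 ≤ u × u ≤ b + t) us)
                 (vs-range : All (λ v → 1 ≤ v × v ≤ c + t) vs)
                 (balanced : t ≡ length us + length vs)
                 (dents! : Unique (dents a b c t us vs))
                 {L : List Lozenge} (isTiling : IsTiling (DentedHex a b c t us vs) L)
                 (N : ℕ) where

  open Hexagon a b c t us vs us-range vs-range

  box : (ℕ → ℕ → Triangle) → List Triangle
  box shape = cartesianProductWith shape (upTo (a + b + t)) (upTo h)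

  ∈-box⁺ : ∀ shape {x y} → x + 1 ≤ a + b + t → y + 1 ≤ h → shape x y ∈ box shape
  ∈-box⁺ shape {x} {y} x<A y<h =
    ∈-cartesianProductWith⁺ shape (∈-upTo⁺ (subst (_≤ a + b + t) (+-comm x 1) x<A)) (∈-upTo⁺ (subst (_≤ h) (+-comm y 1) y<h))

  ∈-box⁻ : ∀ shape {Δ} → Δ ∈ box shape → ∃₂ λ x y → Δ ≡ shape x y
  ∈-box⁻ shape Δ∈ with ∈-cartesianProductWith⁻ shape (upTo (a + b + t)) (upTo h) Δ∈
  ... | x , y , _ , _ , refl = x , y , refl

  box-unique : ∀ shape → (∀ {x x′ y y′} → shape x y ≡ shape x′ y′ → x ≡ x′ × y ≡ y′) → Unique (box shape)
  box-unique shape injective = Unique.cartesianProductWith⁺ shape injective (Unique.upTo⁺ (a + b + t)) (Unique.upTo⁺ h)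

  north? : ∀ Δ → Dec (h ∸ N ≤ row Δ)
  north? Δ = h ∸ N ≤? row Δ

  northern? : ∀ Δ → Dec (InHex a b c t Δ × h ∸ N ≤ row Δ)
  northern? Δ = inHex? Δ ×-dec north? Δ

  northUps northDowns northDents : List Triangle
  northUps   = filter northern? (box up)
  northDowns = filter northern? (box down)
  northDents = filter north? Dents

  northUps-unique : Unique northUps
  northUps-unique = Unique.filter⁺ northern? (box-unique up λ { refl → refl , refl })

  northDowns-unique : Unique northDowns
  northDowns-unique = Unique.filter⁺ northern? (box-unique down λ { refl → refl , refl })

  ∈-northUps⁺ : ∀ {x y} → InHex a b c t (up x y) → h ∸ N ≤ y → up x y ∈ northUps
  ∈-northUps⁺ inside@(y<h , x<A , _) north = ∈-filter⁺ northern? (∈-box⁺ up x<A y<h) (inside , north)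

  ∈-northDowns⁺ : ∀ {x y} → InHex a b c t (down x y) → h ∸ N ≤ y → down x y ∈ northDowns
  ∈-northDowns⁺ inside@(y<h , x<A , _) north = ∈-filter⁺ northern? (∈-box⁺ down x<A y<h) (inside , north)

  coveringLozenge : ∀ {Δ} → Δ ∈ northDowns → ∃ λ ℓ → ℓ ∈ L × downT ℓ ≡ Δ
  coveringLozenge Δ∈ with ∈-filter⁻ northern? Δ∈
  ... | box∈ , inside , _ with ∈-box⁻ down box∈
  ...   | _ , _ , refl with covering L (≤-reflexive (sym (proj₂ isTiling _ (inside , down∉Dents))))
  ...     | ℓ , ℓ∈ , covers = ℓ , ℓ∈ , contains-down⁻ ℓ covers

  coverUp : ∀ {Δ} → Δ ∈ northDowns → Triangle
  coverUp Δ∈ = upT (proj₁ (coveringLozenge Δ∈))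

  coverUp∈northUps : ∀ {Δ} (Δ∈ : Δ ∈ northDowns) → coverUp Δ∈ ∈ northUps
  coverUp∈northUps Δ∈ with coveringLozenge Δ∈
  ... | ℓ , ℓ∈ , refl with upT-shape ℓ
  ...   | x , y , upT≡ = subst (_∈ northUps) (sym upT≡) (∈-northUps⁺ inside north)
    where
    inside : InHex a b c t (up x y)
    inside = subst (InHex a b c t) upT≡ (proj₁ (proj₁ (proj₁ isTiling ℓ ℓ∈)))
    north : h ∸ N ≤ y
    north = ≤-trans (proj₂ (proj₂ (∈-filter⁻ northern? {xs = box down} Δ∈)))
                    (subst (row (downT ℓ) ≤_) (cong row upT≡) (row-downT≤row-upT ℓ))

  coverUp∉Dents : ∀ {Δ} (Δ∈ : Δ ∈ northDowns) → coverUp Δ∈ ∉ Dents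
  coverUp∉Dents Δ∈ with coveringLozenge Δ∈
  ... | ℓ , ℓ∈ , _ = proj₂ (proj₁ (proj₁ isTiling ℓ ℓ∈))

  coverUp-injective : ∀ {Δ₁ Δ₂} (Δ₁∈ : Δ₁ ∈ northDowns) (Δ₂∈ : Δ₂ ∈ northDowns) → coverUp Δ₁∈ ≡ coverUp Δ₂∈ → Δ₁ ≡ Δ₂
  coverUp-injective Δ₁∈ Δ₂∈ e with coveringLozenge Δ₁∈ | coveringLozenge Δ₂∈
  ... | ℓ₁ , ℓ₁∈ , refl | ℓ₂ , ℓ₂∈ , refl = cong downT ℓ₁≡ℓ₂
    where
    ℓ₁≡ℓ₂ : ℓ₁ ≡ ℓ₂
    ℓ₁≡ℓ₂ = covering-unique L (proj₂ isTiling (upT ℓ₁) (proj₁ (proj₁ isTiling ℓ₁ ℓ₁∈))) ℓ₁∈ ℓ₂∈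
              (contains-upT ℓ₁) (subst (λ Δ → contains ℓ₂ Δ ≡ true) (sym e) (contains-upT ℓ₂))

  dent⇒1≤t : ∀ {Δ} → Δ ∈ Dents → 1 ≤ t
  dent⇒1≤t {Δ} Δ∈ = subst (1 ≤_) (sym (trans balanced (sym length-dents))) (nonempty Δ∈)
    where
    length-dents : length Dents ≡ length us + length vs
    length-dents = trans (length-++ (map (neDent a b c t) us))
                         (cong₂ _+_ (length-map (neDent a b c t) us) (length-map (nwDent a b c t) vs))
    nonempty : ∀ {xs : List Triangle} → Δ ∈ xs → 1 ≤ length xs
    nonempty (here _)  = s≤s z≤n
    nonempty (there _) = s≤s z≤n

  mate : ∀ {Δ} → Δ ∈ northDowns ++ northDents → Triangle
  mate Δ∈ with ∈-++⁻ northDowns Δ∈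
  mate Δ∈ | inj₁ down∈ = coverUp down∈
  mate {Δ} Δ∈ | inj₂ _ = Δ

  mate∈northUps : ∀ {Δ} (Δ∈ : Δ ∈ northDowns ++ northDents) → mate Δ∈ ∈ northUps
  mate∈northUps Δ∈ with ∈-++⁻ northDowns Δ∈
  ... | inj₁ down∈ = coverUp∈northUps down∈
  ... | inj₂ dent∈ with ∈-filter⁻ north? dent∈
  ...   | Δ∈Dents , north with dent-inside (dent⇒1≤t Δ∈Dents) Δ∈Dents
  ...     | _ , _ , refl , inside = ∈-northUps⁺ inside north

  mate-injective : ∀ {Δ₁ Δ₂} (Δ₁∈ : Δ₁ ∈ northDowns ++ northDents) (Δ₂∈ : Δ₂ ∈ northDowns ++ northDents) →
                   mate Δ₁∈ ≡ mate Δ₂∈ → Δ₁ ≡ Δ₂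
  mate-injective Δ₁∈ Δ₂∈ e with ∈-++⁻ northDowns Δ₁∈ | ∈-++⁻ northDowns Δ₂∈
  ... | inj₁ down₁∈ | inj₁ down₂∈ = coverUp-injective down₁∈ down₂∈ e
  ... | inj₁ down₁∈ | inj₂ dent₂∈ = contradiction (subst (_∈ Dents) (sym e) (proj₁ (∈-filter⁻ north? dent₂∈))) (coverUp∉Dents down₁∈)
  ... | inj₂ dent₁∈ | inj₁ down₂∈ = contradiction (subst (_∈ Dents) e (proj₁ (∈-filter⁻ north? dent₁∈))) (coverUp∉Dents down₂∈)
  ... | inj₂ _      | inj₂ _      = e

  downs+dents≤ups : length northDowns + length northDents ≤ length northUps
  downs+dents≤ups = subst (_≤ length northUps) (length-++ northDowns)
    (injection⇒length≤ _≟ᵗ_ (Unique.++⁺ northDowns-unique (Unique.filter⁺ north? dents!) disjoint)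
                             mate mate∈northUps mate-injective)
    where
    disjoint : ∀ {Δ} → ¬ (Δ ∈ northDowns × Δ ∈ northDents)
    disjoint (down∈ , dent∈) with ∈-box⁻ down (proj₁ (∈-filter⁻ northern? down∈))
    ... | _ , _ , refl = down∉Dents (proj₁ (∈-filter⁻ north? dent∈))

  -- The down-pointing position just beyond the northeast side in row y.
  eastOf : ℕ → Triangle
  eastOf y = down (a + b + c + t ∸ suc y) y

  northRows : List ℕ
  northRows = applyUpTo (h ∸ N +_) N

  ∈-northRows : ∀ {y} → h ∸ N ≤ y → y < h → y ∈ northRows
  ∈-northRows {y} north y<h = subst (_∈ northRows) (m+[n∸m]≡n north) (∈-applyUpTo⁺ (h ∸ N +_) i<N)
    where
    y<h∸N+N : y < h ∸ N + N
    y<h∸N+N = <-≤-trans y<h (subst (h ≤_) (+-comm N (h ∸ N)) (m≤n+m∸n h N))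
    i<N : y ∸ (h ∸ N) < N
    i<N = subst (y ∸ (h ∸ N) <_) (m+n∸m≡n (h ∸ N) N) (∸-monoˡ-< y<h∸N+N north)

  flip∈ : ∀ {Δ} → Δ ∈ northUps → flip Δ ∈ northDowns ++ map eastOf northRows
  flip∈ Δ∈ with ∈-filter⁻ northern? Δ∈
  ... | box∈ , _ , north with ∈-box⁻ up box∈
  flip∈ Δ∈ | box∈ , (y<h , x<A , sw , ne) , north | x , y , refl with x + y + 2 ≤? a + b + c + t
  ... | yes fits = ∈-++⁺ˡ (∈-northDowns⁺ (y<h , x<A , ≤-trans sw (m≤m+n (x + y) 1) , fits) north)
  ... | no ¬fits = ∈-++⁺ʳ northDowns (subst (λ z → down z y ∈ map eastOf northRows) S∸[1+y]≡x
                                        (∈-map⁺ eastOf (∈-northRows north (subst (_≤ h) (+-comm y 1) y<h))))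
    where
    S≡x+[1+y] : a + b + c + t ≡ x + suc y
    S≡x+[1+y] = trans (≤-antisym (≤-pred (subst (a + b + c + t <_) (+-suc (x + y) 1) (≰⇒> ¬fits))) ne)
                      (trans (+-assoc x y 1) (cong (x +_) (+-comm y 1)))
    S∸[1+y]≡x : a + b + c + t ∸ suc y ≡ x
    S∸[1+y]≡x = trans (cong (_∸ suc y) S≡x+[1+y]) (m+n∸n≡m x (suc y))

  ups≤downs+N : length northUps ≤ length northDowns + N
  ups≤downs+N = subst (length northUps ≤_) length-target
    (injection⇒length≤ _≟ᵗ_ northUps-unique (λ {Δ} _ → flip Δ) flip∈ (λ _ _ → flip-injective))
    where
    length-target : length (northDowns ++ map eastOf northRows) ≡ length northDowns + N
    length-target = trans (length-++ northDowns)
                          (cong (length northDowns +_) (trans (length-map eastOf northRows) (length-applyUpTo (h ∸ N +_) N)))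

  μ≤N : mu a b c t us vs N ≤ N
  μ≤N = +-cancelˡ-≤ (length northDowns) _ _ (≤-trans downs+dents≤ups ups≤downs+N)

data Direction : Set where
  south west east : Direction

-- The catch-all clause also serves south at y = 0 and west at x = 0, where that
-- neighbour does not exist; the tiling never asks for these.
lozengeTowards : Direction → ℕ → ℕ → Lozenge
lozengeTowards south x (suc y) = lozenge (up x (suc y)) (down x y) adj-horiz
lozengeTowards west (suc x) y  = lozenge (up (suc x) y) (down x y) adj-vert
lozengeTowards _ x y           = lozenge (up x y) (down x y) adj-diag

upT-lozengeTowards : ∀ d x y → upT (lozengeTowards d x y) ≡ up x y
upT-lozengeTowards south x zero    = refl
upT-lozengeTowards south x (suc y) = refl
upT-lozengeTowards west zero y     = refl
upT-lozengeTowards west (suc x) y  = refl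
upT-lozengeTowards east x y        = refl

module Construction (a b c t : ℕ) (us vs : List ℕ)
                    (us-range : All (λ u → 1 ≤ u × u ≤ b + t) us)
                    (vs-range : All (λ v → 1 ≤ v × v ≤ c + t) vs)
                    (us! : Unique us) (vs! : Unique vs)
                    (balanced : t ≡ length us + length vs)
                    (μ-bound : ∀ j → 1 ≤ j → atMost j us + atMost j vs ≤ j) where

  open Hexagon a b c t us vs us-range vs-range

  Source Sink : ℕ → Set
  Source k = k ≤ b + t × k ∉ us
  Sink k   = k ∈ vs ⊎ c + t < k

  source? : ∀ k → Dec (Source k)
  source? k = (k ≤? b + t) ×-dec ¬? (k ∈? us)

  sink? : ∀ k → Dec (Sink k)
  sink? k = (k ∈? vs) ⊎-dec (c + t <? k)

  sources sinks : ℕ → ℕ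
  sources = countUpTo source?
  sinks   = countUpTo sink?

  sources-saturated : ∀ k → sources k ≤ sources (b + t)
  sources-saturated k with k ≤? b + t
  ... | yes k≤b+t = countUpTo-mono source? k≤b+t
  sources-saturated zero    | no _ = z≤n
  sources-saturated (suc k) | no 1+k≰b+t =
    ≤-trans (≤-reflexive (countUpTo-suc-no source? (1+k≰b+t ∘ proj₁))) (sources-saturated k)

  private
    suc-⊓ : ∀ {j n} → suc j ≤ n → suc (j ⊓ n) ≡ suc j ⊓ n
    suc-⊓ {j} 1+j≤n = trans (cong suc (m≤n⇒m⊓n≡m (≤-trans (n≤1+n j) 1+j≤n))) (sym (m≤n⇒m⊓n≡m 1+j≤n))

    ⊓-saturated : ∀ {j n} → ¬ suc j ≤ n → j ⊓ n ≡ suc j ⊓ n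
    ⊓-saturated 1+j≰n = trans (m≥n⇒m⊓n≡n (≤-pred (≰⇒> 1+j≰n))) (sym (m≥n⇒m⊓n≡n (<⇒≤ (≰⇒> 1+j≰n))))

  sources+atMost : ∀ j → sources j + atMost j us ≡ j ⊓ (b + t)
  sources+atMost zero    = atMost-zero (All.map proj₁ us-range)
  sources+atMost (suc j) = step (suc j ∈? us) (suc j ≤? b + t)
    where
    open ≡-Reasoning
    ih : sources j + atMost j us ≡ j ⊓ (b + t)
    ih = sources+atMost j
    step : Dec (suc j ∈ us) → Dec (suc j ≤ b + t) → sources (suc j) + atMost (suc j) us ≡ suc j ⊓ (b + t)
    step (yes 1+j∈) _ = begin
      sources (suc j) + atMost (suc j) us ≡⟨ cong₂ _+_ (countUpTo-suc-no source? (λ src → proj₂ src 1+j∈)) (atMost-suc-∈ us! 1+j∈) ⟩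
      sources j + suc (atMost j us)       ≡⟨ trans (+-suc _ _) (cong suc ih) ⟩
      suc (j ⊓ (b + t))                   ≡⟨ suc-⊓ (proj₂ (All.lookup us-range 1+j∈)) ⟩
      suc j ⊓ (b + t)                     ∎
    step (no 1+j∉) (yes 1+j≤b+t) = begin
      sources (suc j) + atMost (suc j) us ≡⟨ cong₂ _+_ (countUpTo-suc-yes source? (1+j≤b+t , 1+j∉)) (atMost-suc-∉ 1+j∉) ⟩
      suc (sources j + atMost j us)       ≡⟨ cong suc ih ⟩
      suc (j ⊓ (b + t))                   ≡⟨ suc-⊓ 1+j≤b+t ⟩
      suc j ⊓ (b + t)                     ∎
    step (no 1+j∉) (no 1+j≰b+t) = begin
      sources (suc j) + atMost (suc j) us ≡⟨ cong₂ _+_ (countUpTo-suc-no source? (1+j≰b+t ∘ proj₁)) (atMost-suc-∉ 1+j∉) ⟩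
      sources j + atMost j us             ≡⟨ ih ⟩
      j ⊓ (b + t)                         ≡⟨ ⊓-saturated 1+j≰b+t ⟩
      suc j ⊓ (b + t)                     ∎

  sinks≡ : ∀ j → sinks j ≡ (j ∸ (c + t)) + atMost j vs
  sinks≡ zero    = sym (cong₂ _+_ (0∸n≡0 (c + t)) (atMost-zero (All.map proj₁ vs-range)))
  sinks≡ (suc j) = step (suc j ∈? vs) (c + t <? suc j)
    where
    open ≡-Reasoning
    ih : sinks j ≡ (j ∸ (c + t)) + atMost j vs
    ih = sinks≡ j
    step : Dec (suc j ∈ vs) → Dec (c + t < suc j) → sinks (suc j) ≡ (suc j ∸ (c + t)) + atMost (suc j) vs
    step (yes 1+j∈) _ = begin
      sinks (suc j)                         ≡⟨ trans (countUpTo-suc-yes sink? (inj₁ 1+j∈)) (cong suc ih) ⟩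
      suc ((j ∸ (c + t)) + atMost j vs)     ≡⟨ +-suc _ _ ⟨
      (j ∸ (c + t)) + suc (atMost j vs)     ≡⟨ cong₂ _+_ (trans (m≤n⇒m∸n≡0 (≤-trans (n≤1+n j) 1+j≤c+t)) (sym (m≤n⇒m∸n≡0 1+j≤c+t)))
                                                         (sym (atMost-suc-∈ vs! 1+j∈)) ⟩
      (suc j ∸ (c + t)) + atMost (suc j) vs ∎
      where
      1+j≤c+t : suc j ≤ c + t
      1+j≤c+t = proj₂ (All.lookup vs-range 1+j∈)
    step (no 1+j∉) (yes c+t<1+j) = begin
      sinks (suc j)                         ≡⟨ trans (countUpTo-suc-yes sink? (inj₂ c+t<1+j)) (cong suc ih) ⟩
      suc (j ∸ (c + t)) + atMost j vs       ≡⟨ cong₂ _+_ (sym (+-∸-assoc 1 (≤-pred c+t<1+j))) (sym (atMost-suc-∉ 1+j∉)) ⟩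
      (suc j ∸ (c + t)) + atMost (suc j) vs ∎
    step (no 1+j∉) (no c+t≮1+j) = begin
      sinks (suc j)                         ≡⟨ trans (countUpTo-suc-no sink? [ 1+j∉ , c+t≮1+j ]) ih ⟩
      (j ∸ (c + t)) + atMost j vs           ≡⟨ cong₂ _+_ (trans (m≤n⇒m∸n≡0 (≤-trans (n≤1+n j) 1+j≤c+t)) (sym (m≤n⇒m∸n≡0 1+j≤c+t)))
                                                         (sym (atMost-suc-∉ 1+j∉)) ⟩
      (suc j ∸ (c + t)) + atMost (suc j) vs ∎
      where
      1+j≤c+t : suc j ≤ c + t
      1+j≤c+t = ≮⇒≥ c+t≮1+j

  sinks≥ : ∀ j → j ∸ (c + t) ≤ sinks j
  sinks≥ j = subst (j ∸ (c + t) ≤_) (sym (sinks≡ j)) (m≤m+n _ _)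

  dents-bound : ∀ j → atMost j us + atMost j vs ≤ j
  dents-bound zero    = ≤-reflexive (cong₂ _+_ (atMost-zero (All.map proj₁ us-range)) (atMost-zero (All.map proj₁ vs-range)))
  dents-bound (suc j) = μ-bound (suc j) (s≤s z≤n)

  -- This is where μ_j ≤ j enters: by row j no more paths have ended than have started.
  sinks≤sources : ∀ {j} → j ≤ h → sinks j ≤ sources j
  sinks≤sources {j} j≤h = +-cancelʳ-≤ (atMost j us) (sinks j) (sources j) (begin
    sinks j + atMost j us          ≡⟨ cong (_+ atMost j us) (sinks≡ j) ⟩
    (j ∸ (c + t)) + atMost j vs + atMost j us ≡⟨ rearrange (j ∸ (c + t)) (atMost j vs) (atMost j us) ⟩
    (j ∸ (c + t)) + M              ≤⟨ ⊓-glb ≤j ≤b+t ⟩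
    j ⊓ (b + t)                    ≡⟨ sources+atMost j ⟨
    sources j + atMost j us        ∎)
    where
    open ≤-Reasoning
    M : ℕ
    M = atMost j us + atMost j vs
    rearrange : ∀ x v u → x + v + u ≡ x + (u + v)
    rearrange = solve-∀
    M≤t : M ≤ t
    M≤t = subst (M ≤_) (sym balanced) (+-mono-≤ (length-filter (_≤? j) us) (length-filter (_≤? j) vs))
    ≤j : (j ∸ (c + t)) + M ≤ j
    ≤j with c + t ≤? j
    ... | yes c+t≤j = ≤-trans (+-monoʳ-≤ (j ∸ (c + t)) (≤-trans M≤t (m≤n+m t c))) (≤-reflexive (m∸n+n≡m c+t≤j))
    ... | no c+t≰j  = subst (λ z → z + M ≤ j) (sym (m≤n⇒m∸n≡0 (<⇒≤ (≰⇒> c+t≰j)))) (dents-bound j)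
    ≤b+t : (j ∸ (c + t)) + M ≤ b + t
    ≤b+t = +-mono-≤ (m≤n+o⇒m∸n≤o j (c + t) (subst (j ≤_) (trans (+-assoc b c t) (+-comm b (c + t))) j≤h)) M≤t

  sources≡sinks : sources h ≡ sinks h
  sources≡sinks = +-cancelʳ-≡ (length us) (sources h) (sinks h) (begin
    sources h + length us                   ≡⟨ cong (sources h +_) (atMost-all us≤h′) ⟨
    sources h + atMost h us                 ≡⟨ sources+atMost h ⟩
    h ⊓ (b + t)                             ≡⟨ m≥n⇒m⊓n≡n b+t≤h ⟩
    b + t                                   ≡⟨ cong (b +_) balanced ⟩
    b + (length us + length vs)             ≡⟨ rearrange b (length us) (length vs) ⟩
    b + length vs + length us               ≡⟨ cong₂ (λ x v → x + v + length us) h∸[c+t]≡b (atMost-all vs≤h′) ⟨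
    (h ∸ (c + t)) + atMost h vs + length us ≡⟨ cong (_+ length us) (sinks≡ h) ⟨
    sinks h + length us                     ∎)
    where
    open ≡-Reasoning
    rearrange : ∀ b u v → b + (u + v) ≡ b + v + u
    rearrange = solve-∀
    us≤h′ : All (_≤ h) us
    us≤h′ = All.map (λ range → ≤-trans (proj₂ range) b+t≤h) us-range
    vs≤h′ : All (_≤ h) vs
    vs≤h′ = All.map (λ range → ≤-trans (proj₂ range) c+t≤h) vs-range
    h∸[c+t]≡b : h ∸ (c + t) ≡ b
    h∸[c+t]≡b = trans (cong (_∸ (c + t)) (+-assoc b c t)) (m+n∸n≡m b (c + t))

  -- The path of source row j runs down column a + j ∸ 1, the column of the j-th
  -- triangle along the northeast side.
  PathColumn : ℕ → Set
  PathColumn x = a ≤ x × Source (suc (x ∸ a))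

  pathColumn? : ∀ x → Dec (PathColumn x)
  pathColumn? x = (a ≤? x) ×-dec source? (suc (x ∸ a))

  pathsWestOf : ℕ → ℕ
  pathsWestOf x = sources (x ∸ a)

  pathsWestOf-suc-yes : ∀ {x} → PathColumn x → pathsWestOf (suc x) ≡ suc (pathsWestOf x)
  pathsWestOf-suc-yes (a≤x , src) = trans (cong sources (+-∸-assoc 1 a≤x)) (countUpTo-suc-yes source? src)

  pathsWestOf-suc-no : ∀ {x} → ¬ PathColumn x → pathsWestOf (suc x) ≡ pathsWestOf x
  pathsWestOf-suc-no {x} ¬path with a ≤? x
  ... | yes a≤x = trans (cong sources (+-∸-assoc 1 a≤x)) (countUpTo-suc-no source? (λ src → ¬path (a≤x , src)))
  ... | no a≰x  = cong sources (trans (m≤n⇒m∸n≡0 (≰⇒> a≰x)) (sym (m≤n⇒m∸n≡0 (<⇒≤ (≰⇒> a≰x)))))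

  pathsWestOf-≤-suc : ∀ x → pathsWestOf x ≤ pathsWestOf (suc x)
  pathsWestOf-≤-suc x = countUpTo-mono source? (∸-monoˡ-≤ a (n≤1+n x))

  pathsWestOf≤ : ∀ x → pathsWestOf x ≤ x
  pathsWestOf≤ x = ≤-trans (countUpTo≤ source? (x ∸ a)) (m∸n≤m x a)

  pathsWestOf-zero : pathsWestOf 0 ≡ 0
  pathsWestOf-zero = cong sources (0∸n≡0 a)

  pathColumn⇒<sinks : ∀ {x} → PathColumn x → pathsWestOf x < sinks h
  pathColumn⇒<sinks {x} path@(_ , 1+j≤b+t , _) = begin-strict
    pathsWestOf x           <⟨ n<1+n _ ⟩
    suc (sources (x ∸ a))   ≡⟨ countUpTo-suc-yes source? (proj₂ path) ⟨
    sources (suc (x ∸ a))   ≤⟨ countUpTo-mono source? (≤-trans 1+j≤b+t b+t≤h) ⟩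
    sources h               ≡⟨ sources≡sinks ⟩
    sinks h                 ∎
    where open ≤-Reasoning

  -- The up-pointing triangle in column x of row k is paired with the triangle below it
  -- (GoesSouth) when x carries a path that has not yet reached its sink row, and with
  -- its western neighbour (GoesWest) when row k is a sink row and x lies at or west of
  -- the column of the path ending there.
  GoesSouth GoesWest : ℕ → ℕ → Set
  GoesSouth x k = PathColumn x × sinks k ≤ pathsWestOf x
  GoesWest x k  = Sink k × pathsWestOf x < sinks k

  goesSouth? : ∀ x k → Dec (GoesSouth x k)
  goesSouth? x k = pathColumn? x ×-dec (sinks k ≤? pathsWestOf x)

  goesWest? : ∀ x k → Dec (GoesWest x k)
  goesWest? x k = sink? k ×-dec (pathsWestOf x <? sinks k)

  goesWest⇒¬goesSouth : ∀ {x k} → GoesWest x k → ¬ GoesSouth x k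
  goesWest⇒¬goesSouth (_ , <sinks) (_ , sinks≤) = <⇒≱ <sinks sinks≤

  goesSouth⇒<h : ∀ {x k} → GoesSouth x k → k < h
  goesSouth⇒<h {x} {k} (path , sinks≤) = ≰⇒> λ h≤k → <⇒≱ (pathColumn⇒<sinks path) (≤-trans (countUpTo-mono sink? h≤k) sinks≤)

  sink⇒1≤sinks : ∀ {k} → 1 ≤ k → Sink k → 1 ≤ sinks k
  sink⇒1≤sinks {suc k} _ sink = subst (1 ≤_) (sym (countUpTo-suc-yes sink? sink)) (s≤s z≤n)

  ¬goesWest⇒sinks≤ : ∀ {x k} → Sink k → ¬ GoesWest x k → sinks k ≤ pathsWestOf x
  ¬goesWest⇒sinks≤ sink ¬west = ≮⇒≥ (λ < → ¬west (sink , <))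

  -- The down-pointing triangle in column x of row suc k is claimed by its northern
  -- neighbour (x , k) if that goes south, by its eastern neighbour (suc x , suc k) if
  -- that goes west, and by its western neighbour (x , suc k) if that goes neither way.
  -- The three claim lemmas say that exactly one of them claims it.
  claim-east⇒¬claim-north : ∀ {x k} → GoesWest (suc x) (suc k) → ¬ GoesSouth x k
  claim-east⇒¬claim-north {x} {k} (sink , <sinks) (path , sinks≤) = <⇒≱ <sinks (begin
    sinks (suc k)          ≡⟨ countUpTo-suc-yes sink? sink ⟩
    suc (sinks k)          ≤⟨ s≤s sinks≤ ⟩
    suc (pathsWestOf x)    ≡⟨ pathsWestOf-suc-yes path ⟨
    pathsWestOf (suc x)    ∎)
    where open ≤-Reasoning

  claim-west⇒¬claim-north-east : ∀ {x k} → ¬ GoesSouth x (suc k) → ¬ GoesWest x (suc k) →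
                                 ¬ GoesSouth x k × ¬ GoesWest (suc x) (suc k)
  claim-west⇒¬claim-north-east {x} {k} ¬south ¬west = ¬north , ¬east
    where
    ¬north : ¬ GoesSouth x k
    ¬north (path , sinks≤) = case sink? (suc k) of λ where
      (yes sink) → ¬west (sink , ≰⇒> (λ ≤ → ¬south (path , ≤)))
      (no ¬sink) → ¬south (path , ≤-trans (≤-reflexive (countUpTo-suc-no sink? ¬sink)) sinks≤)
    ¬east : ¬ GoesWest (suc x) (suc k)
    ¬east (sink , <sinks) = ¬west (sink , ≤-<-trans (pathsWestOf-≤-suc x) <sinks)

  ¬claim-north-east⇒sinks< : ∀ {x k} → Sink (suc k) → ¬ GoesSouth x k → ¬ GoesWest (suc x) (suc k) →
                             sinks k < pathsWestOf x
  ¬claim-north-east⇒sinks< {x} {k} sink ¬south ¬west with pathColumn? x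
  ... | yes path = contradiction (path , ≤-pred (begin
        suc (sinks k)         ≡⟨ countUpTo-suc-yes sink? sink ⟨
        sinks (suc k)         ≤⟨ ¬goesWest⇒sinks≤ sink ¬west ⟩
        pathsWestOf (suc x)   ≡⟨ pathsWestOf-suc-yes path ⟩
        suc (pathsWestOf x)   ∎)) ¬south
    where open ≤-Reasoning
  ... | no ¬path = begin
        suc (sinks k)         ≡⟨ countUpTo-suc-yes sink? sink ⟨
        sinks (suc k)         ≤⟨ ¬goesWest⇒sinks≤ sink ¬west ⟩
        pathsWestOf (suc x)   ≡⟨ pathsWestOf-suc-no ¬path ⟩
        pathsWestOf x         ∎
    where open ≤-Reasoning

  ¬claim-north-east⇒claim-west : ∀ {x k} → ¬ GoesSouth x k → ¬ GoesWest (suc x) (suc k) →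
                                 ¬ GoesSouth x (suc k) × ¬ GoesWest x (suc k)
  ¬claim-north-east⇒claim-west {x} {k} ¬south ¬west = ¬goesSouth , ¬goesWest
    where
    ¬goesSouth : ¬ GoesSouth x (suc k)
    ¬goesSouth (path , sinks≤) = ¬south (path , ≤-trans (countUpTo-mono sink? (n≤1+n k)) sinks≤)
    ¬goesWest : ¬ GoesWest x (suc k)
    ¬goesWest (sink , <sinks) =
      <⇒≱ (¬claim-north-east⇒sinks< sink ¬south ¬west) (≤-pred (subst (pathsWestOf x <_) (countUpTo-suc-yes sink? sink) <sinks))

  eastEnd-column : ∀ {x k} → suc x ≡ a + k → 1 ≤ k → a ≤ x × suc (x ∸ a) ≡ k
  eastEnd-column {x} {k} 1+x≡a+k 1≤k = a≤x , (begin
    suc (x ∸ a)  ≡⟨ +-∸-assoc 1 a≤x ⟨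
    suc x ∸ a    ≡⟨ cong (_∸ a) 1+x≡a+k ⟩
    a + k ∸ a    ≡⟨ m+n∸m≡n a k ⟩
    k            ∎)
    where
    open ≡-Reasoning
    a≤x : a ≤ x
    a≤x = +-cancelʳ-≤ 1 a x (≤-trans (+-monoʳ-≤ a 1≤k) (≤-reflexive (trans (sym 1+x≡a+k) (+-comm 1 x))))

  eastEnd-goesSouth⊎goesWest : ∀ {x k} → suc x ≡ a + k → 1 ≤ k → Source k → GoesSouth x k ⊎ GoesWest x k
  eastEnd-goesSouth⊎goesWest {x} {k} 1+x≡a+k 1≤k src with eastEnd-column 1+x≡a+k 1≤k
  ... | a≤x , refl with sinks (suc (x ∸ a)) ≤? pathsWestOf x
  ...   | yes sinks≤ = inj₁ ((a≤x , src) , sinks≤)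
  ...   | no sinks≰  = case sink? (suc (x ∸ a)) of λ where
          (yes sink) → inj₂ (sink , ≰⇒> sinks≰)
          (no ¬sink) → contradiction (≤-trans (≤-reflexive (countUpTo-suc-no sink? ¬sink)) (sinks≤sources (≤-trans (n≤1+n _) 1+j≤h))) sinks≰
    where
    1+j≤h : suc (x ∸ a) ≤ h
    1+j≤h = ≤-trans (proj₁ src) b+t≤h

  westmost-¬goesWest : ∀ {k} → UpCell 0 k → ¬ GoesWest 0 k
  westmost-¬goesWest (_ , ¬dent)             (inj₁ k∈vs , _)  = ¬dent (inj₂ (refl , k∈vs))
  westmost-¬goesWest ((_ , _ , sw , _) , _) (inj₂ c+t<k , _) = <⇒≱ c+t<k sw

  east-neighbour-inside : ∀ {x k} → ¬ GoesSouth x k → ¬ GoesWest x k → UpCell x k → DownInside x k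
  east-neighbour-inside {x} {k} ¬south ¬west ((1≤k , x<A , sw , ne) , ¬dent) = 1≤k , x<A , ≤-trans sw (n≤1+n _) , notEastEnd
    where
    notEastEnd : suc (suc x) ≤ a + k
    notEastEnd with m≤n⇒m<n∨m≡n ne
    ... | inj₁ 1+x<a+k = 1+x<a+k
    ... | inj₂ 1+x≡a+k = contradiction (eastEnd-goesSouth⊎goesWest 1+x≡a+k 1≤k (k≤b+t , λ k∈ → ¬dent (inj₁ (1+x≡a+k , k∈))))
                                       [ ¬south , ¬west ]
      where
      k≤b+t : k ≤ b + t
      k≤b+t = +-cancelˡ-≤ a k (b + t) (subst₂ _≤_ 1+x≡a+k (+-assoc a b t) x<A)

  north-neighbour-cell : ∀ {x k} → GoesSouth x k → DownInside x (suc k) → UpCell x k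
  north-neighbour-cell {x} {k} ((a≤x , src) , sinks≤) (_ , x<A , sw , ne) = (1≤k , x<A , ≤-pred sw , 1+x≤a+k) , ¬dent
    where
    1+x≤a+k : suc x ≤ a + k
    1+x≤a+k = ≤-pred (subst (suc (suc x) ≤_) (+-suc a k) ne)
    1≤k : 1 ≤ k
    1≤k = +-cancelˡ-≤ a 1 k (≤-trans (subst (_≤ suc x) (+-comm 1 a) (s≤s a≤x)) 1+x≤a+k)
    ¬dent : ¬ IsDent x k
    ¬dent (inj₁ (1+x≡a+k , k∈us)) = proj₂ src (subst (_∈ us) (sym (proj₂ (eastEnd-column 1+x≡a+k 1≤k))) k∈us)
    ¬dent (inj₂ (x≡0 , k∈vs))     =
      <⇒≱ (sink⇒1≤sinks 1≤k (inj₁ k∈vs)) (≤-trans sinks≤ (≤-reflexive (trans (cong pathsWestOf x≡0) pathsWestOf-zero)))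

  east-neighbour-cell : ∀ {x k} → k ≤ h → GoesWest (suc x) k → DownInside x k → UpCell (suc x) k
  east-neighbour-cell {x} {k} k≤h (sink , <sinks) (1≤k , x<A , sw , ne) = (1≤k , 2+x≤A , sw , ne) , ¬dent
    where
    2+x≤A : suc (suc x) ≤ a + b + t
    2+x≤A with m≤n⇒m<n∨m≡n x<A
    ... | inj₁ 1+x<A = 1+x<A
    ... | inj₂ 1+x≡A = contradiction (≤-trans (sinks≤sources k≤h) (sources-saturated k))
                                     (<⇒≱ (subst (_< sinks k) pathsWest≡ <sinks))
      where
      pathsWest≡ : pathsWestOf (suc x) ≡ sources (b + t)
      pathsWest≡ = cong sources (trans (cong (_∸ a) (trans 1+x≡A (+-assoc a b t))) (m+n∸m≡n a (b + t)))
    ¬dent : ¬ IsDent (suc x) k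
    ¬dent (inj₁ (2+x≡a+k , k∈us)) = <⇒≱ <sinks (begin
      sinks k                  ≤⟨ sinks≤sources k≤h ⟩
      sources k                ≡⟨ cong sources column≡ ⟨
      sources (suc (suc x ∸ a)) ≡⟨ countUpTo-suc-no source? (λ src → proj₂ src (subst (_∈ us) (sym column≡) k∈us)) ⟩
      pathsWestOf (suc x)      ∎)
      where
      open ≤-Reasoning
      column≡ : suc (suc x ∸ a) ≡ k
      column≡ = proj₂ (eastEnd-column 2+x≡a+k 1≤k)
    ¬dent (inj₂ (() , _))

  west-neighbour-cell : ∀ {x k} → ¬ GoesSouth x k → ¬ GoesWest (suc x) (suc k) → DownInside x (suc k) → UpCell x (suc k)
  west-neighbour-cell {x} {k} ¬south ¬west (_ , x<A , sw , ne) =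
    (s≤s z≤n , x<A , 1+k≤x+ct , ≤-trans (n≤1+n (suc x)) ne) , ¬dent
    where
    1+k≤x+ct : suc k ≤ x + (c + t)
    1+k≤x+ct with m≤n⇒m<n∨m≡n sw
    ... | inj₁ 1+k<1+x+ct = ≤-pred 1+k<1+x+ct
    ... | inj₂ 1+k≡1+x+ct = contradiction (¬claim-north-east⇒sinks< sink ¬south ¬west) (≤⇒≯ (≤-trans (pathsWestOf≤ x) x≤sinks))
      where
      sink : Sink (suc k)
      sink = inj₂ (subst (c + t <_) (sym 1+k≡1+x+ct) (s≤s (m≤n+m (c + t) x)))
      x≤sinks : x ≤ sinks k
      x≤sinks = ≤-pred (begin
        suc x                    ≡⟨ m+n∸n≡m (suc x) (c + t) ⟨
        suc x + (c + t) ∸ (c + t) ≡⟨ cong (_∸ (c + t)) 1+k≡1+x+ct ⟨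
        suc k ∸ (c + t)          ≤⟨ sinks≥ (suc k) ⟩
        sinks (suc k)            ≡⟨ countUpTo-suc-yes sink? sink ⟩
        suc (sinks k)            ∎)
        where open ≤-Reasoning
    ¬dent : ¬ IsDent x (suc k)
    ¬dent (inj₁ (1+x≡a+1+k , _)) = 1+n≰n (subst (suc (suc x) ≤_) (sym 1+x≡a+1+k) ne)
    ¬dent (inj₂ (x≡0 , 1+k∈vs))  =
      <⇒≱ (subst (sinks k <_) (trans (cong pathsWestOf x≡0) pathsWestOf-zero) (¬claim-north-east⇒sinks< (inj₁ 1+k∈vs) ¬south ¬west)) z≤n

  direction : ℕ → ℕ → Direction
  direction x k with goesSouth? x k | goesWest? x k
  ... | yes _ | _     = south
  ... | no _  | yes _ = west
  ... | no _  | no _  = east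

  direction-south : ∀ {x k} → GoesSouth x k → direction x k ≡ south
  direction-south {x} {k} toSouth with goesSouth? x k
  ... | yes _      = refl
  ... | no ¬south  = contradiction toSouth ¬south

  direction-west : ∀ {x k} → ¬ GoesSouth x k → GoesWest x k → direction x k ≡ west
  direction-west {x} {k} ¬south toWest with goesSouth? x k | goesWest? x k
  ... | yes toSouth | _        = contradiction toSouth ¬south
  ... | no _        | yes _    = refl
  ... | no _        | no ¬west = contradiction toWest ¬west

  direction-east : ∀ {x k} → ¬ GoesSouth x k → ¬ GoesWest x k → direction x k ≡ east
  direction-east {x} {k} ¬south ¬west with goesSouth? x k | goesWest? x k
  ... | yes toSouth | _          = contradiction toSouth ¬south
  ... | no _        | yes toWest = contradiction toWest ¬west
  ... | no _        | no _       = refl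

  tile : ℕ → ℕ → Lozenge
  tile x y = lozengeTowards (direction x (h ∸ y)) x y

  coverer : Triangle → ℕ × ℕ
  coverer (up x y) = x , y
  coverer (down x y) with goesSouth? x (h ∸ suc y) | goesWest? (suc x) (h ∸ y)
  ... | yes _ | _     = x , suc y
  ... | no _  | yes _ = suc x , y
  ... | no _  | no _  = x , y

  coverer-north : ∀ {x y} → GoesSouth x (h ∸ suc y) → coverer (down x y) ≡ (x , suc y)
  coverer-north {x} {y} toSouth with goesSouth? x (h ∸ suc y)
  ... | yes _     = refl
  ... | no ¬south = contradiction toSouth ¬south

  coverer-east : ∀ {x y} → ¬ GoesSouth x (h ∸ suc y) → GoesWest (suc x) (h ∸ y) → coverer (down x y) ≡ (suc x , y)
  coverer-east {x} {y} ¬south toWest with goesSouth? x (h ∸ suc y) | goesWest? (suc x) (h ∸ y)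
  ... | yes toSouth | _        = contradiction toSouth ¬south
  ... | no _        | yes _    = refl
  ... | no _        | no ¬west = contradiction toWest ¬west

  coverer-west : ∀ {x y} → ¬ GoesSouth x (h ∸ suc y) → ¬ GoesWest (suc x) (h ∸ y) → coverer (down x y) ≡ (x , y)
  coverer-west {x} {y} ¬south ¬west with goesSouth? x (h ∸ suc y) | goesWest? (suc x) (h ∸ y)
  ... | yes toSouth | _          = contradiction toSouth ¬south
  ... | no _        | yes toWest = contradiction toWest ¬west
  ... | no _        | no _       = refl

  tile-partner : ∀ {x y} → Region (up x y) → Region (downT (tile x y)) × coverer (downT (tile x y)) ≡ (x , y)
  tile-partner {x} {y} r with goesSouth? x (h ∸ y) | goesWest? x (h ∸ y)
  tile-partner {x} {zero} r | yes toSouth | _ = contradiction (goesSouth⇒<h toSouth) (n≮n h)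
  tile-partner {x} {suc y} r | yes toSouth | _ =
    down-cell⁻ (trans (+-suc y (h ∸ suc y)) (y+[h∸y]≡h {suc y} y<h)) (south-neighbour-inside (proj₁ cell)) , coverer-north toSouth
    where
    y<h : suc y + 1 ≤ h
    y<h = proj₁ (proj₁ r)
    cell : UpCell x (h ∸ suc y)
    cell = up-cell⁺ (y+[h∸y]≡h {suc y} y<h) r
  tile-partner {zero} {y} r | no _ | yes toWest = contradiction toWest (westmost-¬goesWest (up-cell⁺ (y+[h∸y]≡h (proj₁ (proj₁ r))) r))
  tile-partner {suc x} {y} r | no ¬south | yes toWest =
    down-cell⁻ (y+[h∸y]≡h y<h) (west-neighbour-inside (proj₁ cell)) ,
    coverer-east (claim-east⇒¬claim-north (subst (GoesWest (suc x)) (h∸y≡1+[h∸[1+y]] y<h) toWest)) toWest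
    where
    y<h : y + 1 ≤ h
    y<h = proj₁ (proj₁ r)
    cell : UpCell (suc x) (h ∸ y)
    cell = up-cell⁺ (y+[h∸y]≡h y<h) r
  tile-partner {x} {y} r | no ¬south | no ¬west =
    down-cell⁻ (y+[h∸y]≡h y<h) (east-neighbour-inside ¬south ¬west (up-cell⁺ (y+[h∸y]≡h y<h) r)) ,
    coverer-west (proj₁ ¬claims) (subst (λ k → ¬ GoesWest (suc x) k) (sym row≡) (proj₂ ¬claims))
    where
    y<h : y + 1 ≤ h
    y<h = proj₁ (proj₁ r)
    row≡ : h ∸ y ≡ suc (h ∸ suc y)
    row≡ = h∸y≡1+[h∸[1+y]] y<h
    ¬claims : ¬ GoesSouth x (h ∸ suc y) × ¬ GoesWest (suc x) (suc (h ∸ suc y))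
    ¬claims = claim-west⇒¬claim-north-east (subst (λ k → ¬ GoesSouth x k) row≡ ¬south) (subst (λ k → ¬ GoesWest x k) row≡ ¬west)

  coverer-partner : ∀ {x y} → Region (down x y) →
                 Region (uncurry up (coverer (down x y))) × downT (uncurry tile (coverer (down x y))) ≡ down x y
  coverer-partner {x} {y} r with goesSouth? x (h ∸ suc y) | goesWest? (suc x) (h ∸ y)
  ... | yes toSouth | _ =
    up-cell⁻ (1+y+[h∸[1+y]]≡h y<h) (north-neighbour-cell toSouth (down-cell⁺ (y+[1+[h∸[1+y]]]≡h y<h) r)) ,
    cong (λ d → downT (lozengeTowards d x (suc y))) (direction-south toSouth)
    where
    y<h : y + 1 ≤ h
    y<h = proj₁ (proj₁ r)
  ... | no ¬south | yes toWest =
    up-cell⁻ (y+[h∸y]≡h y<h) (east-neighbour-cell (m∸n≤m h y) toWest (down-cell⁺ (y+[h∸y]≡h y<h) r)) ,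
    cong (λ d → downT (lozengeTowards d (suc x) y)) (direction-west (goesWest⇒¬goesSouth toWest) toWest)
    where
    y<h : y + 1 ≤ h
    y<h = proj₁ (proj₁ r)
  ... | no ¬south | no ¬west =
    up-cell⁻ (y+[1+[h∸[1+y]]]≡h y<h) (west-neighbour-cell ¬south ¬west′ (down-cell⁺ (y+[1+[h∸[1+y]]]≡h y<h) r)) ,
    cong (λ d → downT (lozengeTowards d x y))
         (direction-east (subst (λ k → ¬ GoesSouth x k) (sym row≡) (proj₁ claim))
                         (subst (λ k → ¬ GoesWest x k) (sym row≡) (proj₂ claim)))
    where
    y<h : y + 1 ≤ h
    y<h = proj₁ (proj₁ r)
    row≡ : h ∸ y ≡ suc (h ∸ suc y)
    row≡ = h∸y≡1+[h∸[1+y]] y<h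
    ¬west′ : ¬ GoesWest (suc x) (suc (h ∸ suc y))
    ¬west′ = subst (λ k → ¬ GoesWest (suc x) k) row≡ ¬west
    claim : ¬ GoesSouth x (suc (h ∸ suc y)) × ¬ GoesWest x (suc (h ∸ suc y))
    claim = ¬claim-north-east⇒claim-west ¬south ¬west′

  cells : List (ℕ × ℕ)
  cells = filter (region? ∘ uncurry up) (cartesianProduct (upTo (a + b + t)) (upTo h))

  cells-unique : Unique cells
  cells-unique = Unique.filter⁺ (region? ∘ uncurry up) (Unique.cartesianProduct⁺ (Unique.upTo⁺ (a + b + t)) (Unique.upTo⁺ h))

  ∈-cells⁺ : ∀ {p} → Region (uncurry up p) → p ∈ cells
  ∈-cells⁺ {x , y} r@((y<h , x<A , _) , _) = ∈-filter⁺ (region? ∘ uncurry up)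
    (∈-cartesianProduct⁺ (∈-upTo⁺ (subst (_≤ a + b + t) (+-comm x 1) x<A)) (∈-upTo⁺ (subst (_≤ h) (+-comm y 1) y<h))) r

  ∈-cells⁻ : ∀ {p} → p ∈ cells → Region (uncurry up p)
  ∈-cells⁻ p∈ = proj₂ (∈-filter⁻ (region? ∘ uncurry up) {xs = cartesianProduct (upTo (a + b + t)) (upTo h)} p∈)

  tiling : List Lozenge
  tiling = map (uncurry tile) cells

  tiling-inside : ∀ ℓ → ℓ ∈ tiling → Region (upT ℓ) × Region (downT ℓ)
  tiling-inside ℓ ℓ∈ with ∈-map⁻ (uncurry tile) ℓ∈
  ... | (x , y) , p∈ , refl = subst Region (sym (upT-lozengeTowards (direction x (h ∸ y)) x y)) (∈-cells⁻ p∈) , proj₁ (tile-partner (∈-cells⁻ p∈))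

  tiling-covers : ∀ Δ → Region Δ → coverCount tiling Δ ≡ 1
  tiling-covers (up x y) r = coverCount-map≡1 (uncurry tile) cells-unique (∈-cells⁺ r) covers only
    where
    covers : contains (tile x y) (up x y) ≡ true
    covers = subst (λ Δ → contains (tile x y) Δ ≡ true) (upT-lozengeTowards (direction x (h ∸ y)) x y) (contains-upT (tile x y))
    only : ∀ {p} → p ∈ cells → contains (uncurry tile p) (up x y) ≡ true → p ≡ (x , y)
    only {x′ , y′} _ c = up-injective (trans (sym (upT-lozengeTowards (direction x′ (h ∸ y′)) x′ y′)) (contains-up⁻ (tile x′ y′) c))
  tiling-covers (down x y) r =
    coverCount-map≡1 (uncurry tile) cells-unique (∈-cells⁺ (proj₁ (coverer-partner r))) covers only
    where
    covers : contains (uncurry tile (coverer (down x y))) (down x y) ≡ true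
    covers = subst (λ Δ → contains (uncurry tile (coverer (down x y))) Δ ≡ true) (proj₂ (coverer-partner r))
                   (contains-downT (uncurry tile (coverer (down x y))))
    only : ∀ {p} → p ∈ cells → contains (uncurry tile p) (down x y) ≡ true → p ≡ coverer (down x y)
    only {x′ , y′} p∈ c = trans (sym (proj₂ (tile-partner (∈-cells⁻ p∈)))) (cong coverer (contains-down⁻ (tile x′ y′) c))

  hasTiling : HasTiling Region
  hasTiling = tiling , tiling-inside , tiling-covers

strictlyIncreasing⇒unique : ∀ {xs} → Linked _<_ xs → Unique xs
strictlyIncreasing⇒unique increasing = AllPairs.map <⇒≢ (Linked⇒AllPairs <-trans increasing)

proposition4 : (a b c t : ℕ) (us vs : List ℕ) →
    Linked _<_ us → Linked _<_ vs →
    All (λ u → 1 ≤ u × u ≤ b + t) us →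
    All (λ v → 1 ≤ v × v ≤ c + t) vs →
    (0 < a ⊎ All (1 <_) us ⊎ All (1 <_) vs) →
    t ≡ length us + length vs →
    (HasTiling (DentedHex a b c t us vs) ⇔ (∀ N → 1 ≤ N → mu a b c t us vs N ≤ N))
proposition4 a b c t us vs us-increasing vs-increasing us-range vs-range nondegenerate balanced =
  mk⇔ (λ (_ , isTiling) N _ → Necessity.μ≤N a b c t us vs us-range vs-range balanced dents! isTiling N)
      (λ μ≤N → Construction.hasTiling a b c t us vs us-range vs-range us! vs! balanced
                 (λ j 1≤j → subst (_≤ j) (mu≡atMost j) (μ≤N j 1≤j)))
  where
  open Hexagon a b c t us vs us-range vs-range using (mu≡atMost; dents-unique)
  us! : Unique us
  us! = strictlyIncreasing⇒unique us-increasing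
  vs! : Unique vs
  vs! = strictlyIncreasing⇒unique vs-increasing
  dents! : Unique (dents a b c t us vs)
  dents! = dents-unique us! vs! nondegenerate
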